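{- There exists a periodic graph $\mathcal{G}$ with footprint $G$ such that $c(\mathcal{G})<c(G)<c(G_{\max})$.
   Context: All graphs are finite, undirected and reflexive. A periodic graph with period $p\ge1$ is a sequence $\mathcal{G}=(G_0,\dots,G_{p-1})$ of graphs $G_i=(V,E_i)$ on a common vertex set, extended by $G_{i+p}=G_i$; its footprint is $G=(V,\bigcup_iE_i)$, assumed connected. Cops and Robber on a periodic graph with $k$ cops (perfect information): cops choose starting vertices, then the robber; in each round $t=0,1,\dots$ each cop moves to a vertex of $N_{G_{t\bmod p}}[\text{its position}]$, then the robber likewise; the cops win if a cop ever moves onto the robber's vertex. The cop number $c(\cdot)$ is the least $k$ such that $k$ cops have a winning strategy; a static graph is a periodic graph of period $1$. $c(G_{\max})=\max_{0\le i\le p-1}c(G_i)$. -}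

module Defs where

open import Data.Nat using (ℕ; zero; suc; _<_; _⊔_; NonZero)
open import Data.Nat.DivMod using (_mod_)
open import Data.Fin using (Fin; zero; suc)
open import Data.Product using (Σ; ∃; _×_; _,_)
open import Data.Sum using (_⊎_)
open import Function using (_∘_)
open import Relation.Binary.PropositionalEquality using (_≡_)
open import Relation.Nullary using (¬_)

record Graph (n : ℕ) : Set₁ where
  field
    Adj      : Fin n → Fin n → Set
    adj-refl : ∀ v → Adj v v
    adj-sym  : ∀ {u v} → Adj u v → Adj v u

open Graph public

record PeriodicGraph (n : ℕ) : Set₁ where
  field
    period          : ℕ
    {{period≢0}}    : NonZero period
    graph           : Fin period → Graph n

  at : ℕ → Graph n
  at t = graph (t mod period)

open PeriodicGraph public

footprint : ∀ {n} → PeriodicGraph n → Graph n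
footprint 𝒢 = record
  { Adj      = λ u v → Σ (Fin (period 𝒢)) λ i → Adj (graph 𝒢 i) u v
  ; adj-refl = λ v → (0 mod period 𝒢) , adj-refl (graph 𝒢 (0 mod period 𝒢)) v
  ; adj-sym  = λ { (i , e) → i , adj-sym (graph 𝒢 i) e }
  }

static : ∀ {n} → Graph n → PeriodicGraph n
static G = record { period = 1 ; graph = λ _ → G }

data Walk {n} (G : Graph n) : Fin n → Fin n → Set where
  here : ∀ {v} → Walk G v v
  step : ∀ {u v w} → Adj G u v → Walk G v w → Walk G u w

Connected : ∀ {n} → Graph n → Set
Connected G = ∀ u v → Walk G u v

Cops : ℕ → ℕ → Set
Cops n k = Fin k → Fin n

CopMove : ∀ {n k} → Graph n → Cops n k → Cops n k → Set
CopMove H cs cs' = ∀ j → Adj H (cs j) (cs' j)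

Caught : ∀ {n k} → Cops n k → Fin n → Set
Caught cs r = ∃ λ j → cs j ≡ r

-- CopsWin 𝒢 k t cs r : at the start of round t, with cops at cs and the robber
-- at r, the cops have a strategy guaranteeing capture in finitely many rounds.
-- (Well-founded strategy tree: cops choose a legal move in G_t; either a cop
-- lands on the robber, or for every legal robber reply in G_t the cops win
-- from round t+1.)
data CopsWin {n} (𝒢 : PeriodicGraph n) (k : ℕ) : ℕ → Cops n k → Fin n → Set where
  move : ∀ {t cs r} (cs' : Cops n k) → CopMove (at 𝒢 t) cs cs' →
         Caught cs' r ⊎ (∀ r' → Adj (at 𝒢 t) r r' → CopsWin 𝒢 k (suc t) cs' r') →
         CopsWin 𝒢 k t cs r

CopsWinWith : ∀ {n} → PeriodicGraph n → ℕ → Set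
CopsWinWith 𝒢 k = Σ (Cops _ k) λ cs → ∀ r → CopsWin 𝒢 k 0 cs r

IsCopNumber : ∀ {n} → PeriodicGraph n → ℕ → Set
IsCopNumber 𝒢 k = CopsWinWith 𝒢 k × (∀ j → j < k → ¬ CopsWinWith 𝒢 j)

maxF : ∀ p → (Fin p → ℕ) → ℕ
maxF zero    f = 0
maxF (suc p) f = f zero ⊔ maxF p (f ∘ suc)

-- Take the 4-cycle 0 – 1 – 2 – 3 – 0 and let G_i consist of the single edge
-- {i, i+1} (indices mod 4). Each G_i has three components, and fewer cops than
-- components never catch a robber who starts in a cop-free component, so
-- c(G_i) = 3. The footprint is C₄: two opposite cops dominate it, while a single
-- cop is evaded by a robber who always stays antipodal, so c(C₄) = 2. In the
-- periodic graph one cop starting at 0 rides the rotating edge around the cycle;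
-- a robber can only move while he is on the current edge, so he is swept up
-- within one period, whence c(𝒢) = 1.
module Submission where

open import Defs
open import Data.Nat using (ℕ; zero; suc; _≤_; _<_; _≤′_; ≤′-refl; ≤′-step; z≤n; s≤s; s≤s⁻¹)
open import Data.Nat.Properties using (≤⇒≤′)
open import Data.Fin using (Fin; zero; suc; _≟_)
open import Data.Fin.Properties using (any?; all?; pigeonhole; <-irrefl; ¬∀⟶∃¬)
open import Data.Vec.Functional using ([]; _∷_; updateAt)
open import Data.Vec.Functional.Properties using (updateAt-updates; updateAt-minimal)
open import Data.Product using (Σ; ∃; _×_; _,_; proj₁; proj₂)
open import Data.Sum using (_⊎_; inj₁; inj₂)
open import Data.Empty using (⊥-elim)
open import Function using (const; _∘_)
open import Relation.Binary.PropositionalEquality using (_≡_; _≢_; refl; sym; trans; cong; subst)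
open import Relation.Nullary using (¬_; yes; no)
open import Relation.Nullary.Decidable using (Dec; from-yes; _×-dec_; _⊎-dec_; _→-dec_; ¬?)

module _ {n : ℕ} {G : Graph n} where

  _++ʷ_ : ∀ {u v w} → Walk G u v → Walk G v w → Walk G u w
  here     ++ʷ q = q
  step e p ++ʷ q = step e (p ++ʷ q)

  reverseʷ : ∀ {u v} → Walk G u v → Walk G v u
  reverseʷ here       = here
  reverseʷ (step e p) = reverseʷ p ++ʷ step (adj-sym G e) here

  connected-from : ∀ root → (∀ v → Walk G root v) → Connected G
  connected-from root walk u v = reverseʷ (walk u) ++ʷ walk v

module _ {n : ℕ} {𝒢 : PeriodicGraph n} where

  ¬CopsWin-0 : ∀ {t cs r} → ¬ CopsWin 𝒢 0 t cs r
  ¬CopsWin-0 (move _ _ (inj₁ (() , _)))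
  ¬CopsWin-0 {t} {r = r} (move _ _ (inj₂ w)) = ¬CopsWin-0 (w r (adj-refl (at 𝒢 t) r))

  CopMove-idle : ∀ {k t} {cs cs′ : Cops n k} v → CopMove (at 𝒢 t) cs cs′ → CopMove (at 𝒢 t) (v ∷ cs) (v ∷ cs′)
  CopMove-idle {t = t} v mv zero    = adj-refl (at 𝒢 t) v
  CopMove-idle         v mv (suc j) = mv j

  CopsWin-idle : ∀ {k t cs r} v → CopsWin 𝒢 k t cs r → CopsWin 𝒢 (suc k) t (v ∷ cs) r
  CopsWin-idle v (move cs′ mv (inj₁ (j , caught))) = move (v ∷ cs′) (CopMove-idle v mv) (inj₁ (suc j , caught))
  CopsWin-idle v (move cs′ mv (inj₂ w)) =
    move (v ∷ cs′) (CopMove-idle v mv) (inj₂ λ r′ r→r′ → CopsWin-idle v (w r′ r→r′))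

  capture : ∀ {k t cs r} j → Adj (at 𝒢 t) (cs j) r → CopsWin 𝒢 k t cs r
  capture {t = t} {cs} {r} j e = move (updateAt cs j (const r)) moves (inj₁ (j , updateAt-updates j cs))
    where
    moves : CopMove (at 𝒢 t) cs (updateAt cs j (const r))
    moves i with i ≟ j
    ... | yes refl = subst (Adj (at 𝒢 t) (cs i)) (sym (updateAt-updates i cs)) e
    ... | no i≢j   = subst (Adj (at 𝒢 t) (cs i)) (sym (updateAt-minimal i j cs i≢j)) (adj-refl (at 𝒢 t) (cs i))

  dominating-set-wins : ∀ {k} (cs : Cops n k) → (∀ r → ∃ λ j → Adj (at 𝒢 0) (cs j) r) → CopsWinWith 𝒢 k
  dominating-set-wins cs dominates = cs , λ r → capture (proj₁ (dominates r)) (proj₂ (dominates r))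

  Isolated : ℕ → Fin n → Set
  Isolated t r = ∀ {r′} → Adj (at 𝒢 t) r r′ → r′ ≡ r

  pursue : ∀ {t c c′ r} → Adj (at 𝒢 t) c c′ → Isolated t r →
           CopsWin 𝒢 1 (suc t) (const c′) r → CopsWin 𝒢 1 t (const c) r
  pursue {t} e isolated w =
    move _ (const e) (inj₂ λ r′ r→r′ → subst (CopsWin 𝒢 1 (suc t) _) (sym (isolated r→r′)) w)

module _ {n : ℕ} {𝒢 : PeriodicGraph (suc n)} where

  ¬CopsWinWith-0 : ¬ CopsWinWith 𝒢 0
  ¬CopsWinWith-0 (cs , w) = ¬CopsWin-0 (w zero)

  CopsWinWith-suc : ∀ {k} → CopsWinWith 𝒢 k → CopsWinWith 𝒢 (suc k)
  CopsWinWith-suc (cs , w) = zero ∷ cs , CopsWin-idle zero ∘ w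

  CopsWinWith-mono : ∀ {j k} → j ≤ k → CopsWinWith 𝒢 j → CopsWinWith 𝒢 k
  CopsWinWith-mono = go ∘ ≤⇒≤′
    where
    go : ∀ {j k} → j ≤′ k → CopsWinWith 𝒢 j → CopsWinWith 𝒢 k
    go ≤′-refl w = w
    go (≤′-step j≤k) w = CopsWinWith-suc (go j≤k w)

  isCopNumber : ∀ {k} → CopsWinWith 𝒢 (suc k) → ¬ CopsWinWith 𝒢 k → IsCopNumber 𝒢 (suc k)
  isCopNumber win lose = win , λ j j<1+k w → lose (CopsWinWith-mono (s≤s⁻¹ j<1+k) w)

missing-value : ∀ {k m} → k < m → (f : Fin k → Fin m) → ∃ λ c → ∀ j → f j ≢ c
missing-value {m = m} k<m f with all? (λ c → any? (λ j → f j ≟ c))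
... | yes hit =
  let (c , c′ , c<c′ , same) = pigeonhole k<m (λ c → proj₁ (hit c))
  in ⊥-elim (<-irrefl (trans (sym (proj₂ (hit c))) (trans (cong f same) (proj₂ (hit c′)))) c<c′)
... | no ¬hit =
  let (c , unhit) = ¬∀⟶∃¬ m _ (λ c → any? (λ j → f j ≟ c)) ¬hit
  in c , λ j fj≡c → unhit (j , fj≡c)

module _ {n : ℕ} (H : Graph n) where

  module _ {m : ℕ} (label : Fin n → Fin m) (label-adj : ∀ {u v} → Adj H u v → label u ≡ label v) where

    free-component-escapes : ∀ {k t cs r} → (∀ j → label (cs j) ≢ label r) → ¬ CopsWin (static H) k t cs r
    free-component-escapes free (move cs′ mv (inj₁ (j , caught))) =
      free j (trans (label-adj (mv j)) (cong label caught))
    free-component-escapes {r = r} free (move cs′ mv (inj₂ w)) =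
      free-component-escapes (λ j → free j ∘ trans (label-adj (mv j))) (w r (adj-refl H r))

    fewer-cops-than-components-lose : (∀ c → ∃ λ v → label v ≡ c) → ∀ {k} → k < m → ¬ CopsWinWith (static H) k
    fewer-cops-than-components-lose inhabited k<m (cs , w) =
      let (c , unoccupied) = missing-value k<m (label ∘ cs)
          (v , v∈c) = inhabited c
      in free-component-escapes (λ j → subst (label (cs j) ≢_) (sym v∈c) (unoccupied j)) (w v)

  module _ (opp : Fin n → Fin n) (opp-nonadjacent : ∀ v → ¬ Adj H v (opp v))
           (opp-preserves-adj : ∀ {u v} → Adj H u v → Adj H (opp u) (opp v)) where

    antipodal-robber-escapes : ¬ CopsWinWith (static H) 1
    antipodal-robber-escapes (cs , w) = stay-antipodal (w (opp (cs zero)))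
      where
      stay-antipodal : ∀ {t cs} → ¬ CopsWin (static H) 1 t cs (opp (cs zero))
      stay-antipodal {cs = cs} (move cs′ mv (inj₁ (zero , caught))) =
        opp-nonadjacent (cs zero) (subst (Adj H (cs zero)) caught (mv zero))
      stay-antipodal (move cs′ mv (inj₂ w)) = stay-antipodal (w (opp (cs′ zero)) (opp-preserves-adj (mv zero)))

module _ {n : ℕ} where

  singleEdge : Fin n → Fin n → Graph n
  singleEdge a b = record
    { Adj      = λ u v → u ≡ v ⊎ (u ≡ a × v ≡ b) ⊎ (u ≡ b × v ≡ a)
    ; adj-refl = λ v → inj₁ refl
    ; adj-sym  = λ { (inj₁ u≡v) → inj₁ (sym u≡v)
                   ; (inj₂ (inj₁ (u≡a , v≡b))) → inj₂ (inj₂ (v≡b , u≡a))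
                   ; (inj₂ (inj₂ (u≡b , v≡a))) → inj₂ (inj₁ (v≡a , u≡b)) }
    }

  singleEdge-adj? : ∀ a b u v → Dec (Adj (singleEdge a b) u v)
  singleEdge-adj? a b u v = u ≟ v ⊎-dec (u ≟ a ×-dec v ≟ b) ⊎-dec (u ≟ b ×-dec v ≟ a)

  singleEdge-edge : ∀ a b → Adj (singleEdge a b) a b
  singleEdge-edge a b = inj₂ (inj₁ (refl , refl))

  singleEdge-isolated : ∀ {a b r r′} → r ≢ a → r ≢ b → Adj (singleEdge a b) r r′ → r′ ≡ r
  singleEdge-isolated r≢a r≢b (inj₁ r≡r′)             = sym r≡r′
  singleEdge-isolated r≢a r≢b (inj₂ (inj₁ (r≡a , _))) = ⊥-elim (r≢a r≡a)
  singleEdge-isolated r≢a r≢b (inj₂ (inj₂ (r≡b , _))) = ⊥-elim (r≢b r≡b)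

pattern 0F = zero
pattern 1F = suc zero
pattern 2F = suc (suc zero)
pattern 3F = suc (suc (suc zero))

next : Fin 4 → Fin 4
next 0F = 1F
next 1F = 2F
next 2F = 3F
next 3F = 0F

rotating : Fin 4 → Graph 4
rotating i = singleEdge i (next i)

rotatingEdge : PeriodicGraph 4
rotatingEdge = record { period = 4 ; graph = rotating }

C₄ : Graph 4
C₄ = footprint rotatingEdge

C₄-adj? : ∀ u v → Dec (Adj C₄ u v)
C₄-adj? u v = any? λ i → singleEdge-adj? i (next i) u v

C₄-next : ∀ v → Adj C₄ v (next v)
C₄-next v = v , singleEdge-edge v (next v)

C₄-connected : Connected C₄
C₄-connected = connected-from 0F walk
  where
  walk : ∀ v → Walk C₄ 0F v
  walk 0F = here
  walk 1F = step (C₄-next 0F) here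
  walk 2F = step (C₄-next 0F) (step (C₄-next 1F) here)
  walk 3F = step (C₄-next 0F) (step (C₄-next 1F) (step (C₄-next 2F) here))

sweep : ∀ r → CopsWin rotatingEdge 1 0 (const 0F) r
sweep 0F = capture zero (adj-refl (rotating 0F) 0F)
sweep 1F = capture zero (singleEdge-edge 0F 1F)
sweep 2F = pursue (singleEdge-edge 0F 1F) (singleEdge-isolated (λ ()) (λ ()))
             (capture zero (singleEdge-edge 1F 2F))
sweep 3F = pursue (singleEdge-edge 0F 1F) (singleEdge-isolated (λ ()) (λ ()))
             (pursue (singleEdge-edge 1F 2F) (singleEdge-isolated (λ ()) (λ ()))
               (capture zero (singleEdge-edge 2F 3F)))

antipode : Fin 4 → Fin 4
antipode = next ∘ next

C₄-dominated-by-antipodes : ∀ r → ∃ λ j → Adj C₄ ((0F ∷ 2F ∷ []) j) r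
C₄-dominated-by-antipodes = from-yes (all? λ r → any? λ j → C₄-adj? ((0F ∷ 2F ∷ []) j) r)

C₄-antipode-nonadjacent : ∀ v → ¬ Adj C₄ v (antipode v)
C₄-antipode-nonadjacent = from-yes (all? λ v → ¬? (C₄-adj? v (antipode v)))

C₄-antipode-preserves-adj : ∀ {u v} → Adj C₄ u v → Adj C₄ (antipode u) (antipode v)
C₄-antipode-preserves-adj {u} {v} = from-yes adj⇒adj u v
  where
  adj⇒adj : Dec (∀ u v → Adj C₄ u v → Adj C₄ (antipode u) (antipode v))
  adj⇒adj = all? λ u → all? λ v → C₄-adj? u v →-dec C₄-adj? (antipode u) (antipode v)

component : Fin 4 → Fin 4 → Fin 3
component i u with u ≟ antipode i | u ≟ next (antipode i)
... | yes _ | _     = 1F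
... | no _  | yes _ = 2F
... | no _  | no _  = 0F

component-edge : ∀ i → component i i ≡ component i (next i)
component-edge = from-yes (all? λ i → component i i ≟ component i (next i))

component-adj : ∀ i {u v} → Adj (rotating i) u v → component i u ≡ component i v
component-adj i (inj₁ refl)                = refl
component-adj i (inj₂ (inj₁ (refl , refl))) = component-edge i
component-adj i (inj₂ (inj₂ (refl , refl))) = sym (component-edge i)

component-inhabited : ∀ i c → ∃ λ v → component i v ≡ c
component-inhabited = from-yes (all? λ i → all? λ c → any? λ v → component i v ≟ c)

componentCops : Fin 4 → Cops 4 3
componentCops i = i ∷ antipode i ∷ next (antipode i) ∷ []

rotating-dominated : ∀ i r → ∃ λ j → Adj (rotating i) (componentCops i j) r
rotating-dominated = from-yes (all? λ i → all? λ r → any? λ j → singleEdge-adj? i (next i) (componentCops i j) r)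

proposition4 :
    Σ ℕ λ n → Σ (PeriodicGraph n) λ 𝒢 →
      Connected (footprint 𝒢) ×
      Σ ℕ λ c𝒢 → Σ ℕ λ cG → Σ (Fin (period 𝒢) → ℕ) λ ci →
        IsCopNumber 𝒢 c𝒢 ×
        IsCopNumber (static (footprint 𝒢)) cG ×
        (∀ i → IsCopNumber (static (graph 𝒢 i)) (ci i)) ×
        c𝒢 < cG × cG < maxF (period 𝒢) ci
proposition4 = 4 , rotatingEdge , C₄-connected , 1 , 2 , const 3 ,
  isCopNumber (const 0F , sweep) ¬CopsWinWith-0 ,
  isCopNumber (dominating-set-wins _ C₄-dominated-by-antipodes)
              (antipodal-robber-escapes C₄ antipode C₄-antipode-nonadjacent C₄-antipode-preserves-adj) ,
  (λ i → isCopNumber (dominating-set-wins (componentCops i) (rotating-dominated i))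
                     (fewer-cops-than-components-lose (rotating i) (component i) (component-adj i)
                                                      (component-inhabited i) (s≤s (s≤s (s≤s z≤n))))) ,
  s≤s (s≤s z≤n) , s≤s (s≤s (s≤s z≤n))
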